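{- Let $n$ be a positive integer. If the complete graph $K_n$ is multiplicative in the class $\mathcal{D}$ of finite digraphs, then the complete graph $K_{N}$ with $N=\binom{n}{\lfloor n/2\rfloor}$ is multiplicative in the class $\mathcal{G}$ of finite graphs.
   Context: A finite digraph $G$ consists of a finite vertex set, a finite arc set, and tail/head maps from arcs to vertices; a homomorphism $G\to H$ is a pair of maps on vertices and arcs commuting with tails and heads; we write $G\to H$ if a homomorphism exists. A graph is a simple digraph (at most one arc from $u$ to $v$) whose arc relation is symmetric. The product $G\times H$ has vertex set $V(G)\times V(H)$ and arc set $A(G)\times A(H)$ with tail and head taken coordinatewise; the product of graphs is a graph. $K_m$ is the graph with vertex set $\{0,\dots,m-1\}$ and arcs $(i,j)$ for $i\ne j$. For a class $\mathcal{C}$ (either all finite digraphs $\mathcal{D}$ or all finite graphs $\mathcal{G}$), an object $K\in\mathcal{C}$ is multiplicative in $\mathcal{C}$ if for all $G,H\in\mathcal{C}$, $G\times H\to K$ implies $G\to K$ or $H\to K$. -}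

module Defs where

open import Level using (0ℓ)
open import Data.Nat using (ℕ; _/_)
open import Data.Nat.Combinatorics using (_C_)
open import Data.Fin using (Fin)
open import Data.Product using (Σ; _×_; _,_; proj₁; proj₂; ∃)
open import Data.Sum using (_⊎_)
open import Relation.Binary.PropositionalEquality using (_≡_; _≢_)
open import Function.Bundles using (_↔_)

record Digraph : Set₁ where
  field
    V    : Set
    A    : Set
    tail : A → V
    head : A → V
open Digraph public

IsFiniteSet : Set → Set
IsFiniteSet X = Σ ℕ (λ n → X ↔ Fin n)

IsFinite : Digraph → Set
IsFinite G = IsFiniteSet (V G) × IsFiniteSet (A G)

IsSimple : Digraph → Set
IsSimple G = ∀ (a b : A G) → tail G a ≡ tail G b → head G a ≡ head G b → a ≡ b

IsSymmetric : Digraph → Set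
IsSymmetric G = ∀ (a : A G) → Σ (A G) (λ b → tail G b ≡ head G a × head G b ≡ tail G a)

IsGraph : Digraph → Set
IsGraph G = IsSimple G × IsSymmetric G

record Hom (G H : Digraph) : Set where
  field
    vmap : V G → V H
    amap : A G → A H
    tail-comm : ∀ a → tail H (amap a) ≡ vmap (tail G a)
    head-comm : ∀ a → head H (amap a) ≡ vmap (head G a)

_⟶_ : Digraph → Digraph → Set
G ⟶ H = Hom G H

_⊗_ : Digraph → Digraph → Digraph
G ⊗ H = record
  { V    = V G × V H
  ; A    = A G × A H
  ; tail = λ p → tail G (proj₁ p) , tail H (proj₂ p)
  ; head = λ p → head G (proj₁ p) , head H (proj₂ p)
  }

K : ℕ → Digraph
K m = record
  { V    = Fin m
  ; A    = Σ (Fin m × Fin m) (λ p → proj₁ p ≢ proj₂ p)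
  ; tail = λ a → proj₁ (proj₁ a)
  ; head = λ a → proj₂ (proj₁ a)
  }

MultiplicativeDigraphs : Digraph → Set₁
MultiplicativeDigraphs K′ =
  ∀ (G H : Digraph) → IsFinite G → IsFinite H →
    (G ⊗ H) ⟶ K′ → (G ⟶ K′) ⊎ (H ⟶ K′)

MultiplicativeGraphs : Digraph → Set₁
MultiplicativeGraphs K′ =
  ∀ (G H : Digraph) → IsFinite G → IsGraph G → IsFinite H → IsGraph H →
    (G ⊗ H) ⟶ K′ → (G ⟶ K′) ⊎ (H ⟶ K′)

-- Identify the vertices of K_N with the ⌊n/2⌋-subsets of an n-set. A homomorphism
-- G × H → K_N assigns to every arc an element lying in the set of its head but not in
-- that of its tail, so consecutive arcs receive distinct elements: this is a
-- homomorphism δG × δH → K_n of line digraphs. By multiplicativity of K_n one factor,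
-- say δG, maps to K_n; the set S_v of colours of arcs entering v then satisfies
-- S_head ⊈ S_tail along every arc, so in a symmetric G adjacent vertices carry
-- incomparable sets. Moving each set along a symmetric chain decomposition of the
-- Boolean lattice to the middle level sends incomparable sets to distinct ⌊n/2⌋-sets,
-- which gives G → K_N.

module Submission where

open import Defs
open import Level using (0ℓ)
open import Data.Nat
  using (ℕ; zero; suc; _+_; _*_; _∸_; _/_; _≤_; _<_; z≤n; s≤s; pred; >-nonZero; _≤?_; _<?_)
open import Data.Nat.Properties
  using ( suc-injective; ≤-refl; ≤-reflexive; ≤-antisym; ≤-total; <-irrefl; <-irrelevant; ≤-<-trans
        ; <⇒≤; ≮⇒≥; m≤n⇒m<n∨m≡n; m≤n⇒m≤1+n; <⇒≤pred; m≤pred[n]⇒suc[m]≤n; suc-pred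
        ; +-suc; m≤m+n; m≤n+o⇒m∸n≤o; m+[n∸m]≡n; module ≤-Reasoning )
open import Data.Nat.DivMod using (m*n/n≡m; /-monoˡ-≤)
open import Data.Nat.Combinatorics using (_C_; nCk+nC[k+1]≡[n+1]C[k+1])
open import Data.Nat.Tactic.RingSolver using (solve-∀)
open import Data.Fin using (Fin; zero; suc; splitAt; _↑ˡ_; _↑ʳ_)
open import Data.Fin.Properties using (splitAt-↑ˡ; splitAt-↑ʳ; +↔⊎; any?)
open import Data.Fin.Subset using (Subset; inside; outside; ⊥; _∈_; _∉_; _⊆_; _⊈_; ∣_∣)
open import Data.Fin.Subset.Properties using (drop-there; ∣⊥∣≡0; ⊆-refl; ⊆-trans; s⊆s; out⊆)
open import Data.Vec using ([]; _∷_; here; there; tabulate)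
open import Data.Vec.Properties
  using (∷-injectiveˡ; ∷-injectiveʳ; lookup∘tabulate; lookup⇒[]=; []=⇒lookup)
open import Data.List using (List; length; lookup; filter; cartesianProduct; allFin)
import Data.List as List
open import Data.List.Membership.Propositional using () renaming (_∈_ to _∈ₗ_)
open import Data.List.Membership.Propositional.Properties
  using (∈-map⁺; ∈-allFin; ∈-filter⁺; ∈-filter⁻; ∈-cartesianProduct⁺; ∈-lookup)
open import Data.List.Relation.Unary.Any using (index)
open import Data.List.Relation.Unary.Any.Properties using (lookup-index)
open import Data.Product using (Σ; ∃; _×_; _,_; proj₁; proj₂; uncurry)
import Data.Product as Prod
open import Data.Sum using (_⊎_; inj₁; inj₂)
import Data.Sum as Sum
import Data.Fin.Properties as Fin
open import Data.Unit using (⊤; tt)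
open import Data.Empty using (⊥-elim)
open import Function using (_∘_)
open import Function.Bundles using (Injection; Inverse)
open import Function.Properties.Inverse using (↔⇒↣; ↔-refl)
open import Relation.Nullary using (¬_; Dec; yes; no; does; contradiction; _×-dec_)
open import Relation.Nullary.Decidable using (dec-true; map′; via-injection)
open import Relation.Unary using (Pred; Decidable)
open import Relation.Binary.Definitions using (DecidableEquality)
open import Relation.Binary.PropositionalEquality

Comparable : ∀ {n} → Subset n → Subset n → Set
Comparable p q = p ⊆ q ⊎ q ⊆ p

∣p∣≡0⇒p≡⊥ : ∀ {n} {p : Subset n} → ∣ p ∣ ≡ 0 → p ≡ ⊥
∣p∣≡0⇒p≡⊥ {p = []}          _     = refl
∣p∣≡0⇒p≡⊥ {p = outside ∷ p} |p|≡0 = cong (outside ∷_) (∣p∣≡0⇒p≡⊥ |p|≡0)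

private
  ∃∈∉-suc : ∀ {n s t} {p q : Subset n} →
            ∃ (λ x → x ∈ q × x ∉ p) → ∃ (λ x → x ∈ t ∷ q × x ∉ s ∷ p)
  ∃∈∉-suc (x , x∈q , x∉p) = suc x , there x∈q , x∉p ∘ drop-there

∣p∣≤∣q∣⇒p≢q⇒∃x∈q∉p : ∀ {n} {p q : Subset n} → ∣ p ∣ ≤ ∣ q ∣ → p ≢ q →
                     ∃ λ x → x ∈ q × x ∉ p
∣p∣≤∣q∣⇒p≢q⇒∃x∈q∉p {p = []}          {[]}          _        p≢q = ⊥-elim (p≢q refl)
∣p∣≤∣q∣⇒p≢q⇒∃x∈q∉p {p = outside ∷ p} {inside ∷ q}  _        _   = zero , here , λ ()
∣p∣≤∣q∣⇒p≢q⇒∃x∈q∉p {p = inside ∷ p}  {inside ∷ q}  (s≤s le) p≢q =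
  ∃∈∉-suc (∣p∣≤∣q∣⇒p≢q⇒∃x∈q∉p le (p≢q ∘ cong (inside ∷_)))
∣p∣≤∣q∣⇒p≢q⇒∃x∈q∉p {p = outside ∷ p} {outside ∷ q} le       p≢q =
  ∃∈∉-suc (∣p∣≤∣q∣⇒p≢q⇒∃x∈q∉p le (p≢q ∘ cong (outside ∷_)))
∣p∣≤∣q∣⇒p≢q⇒∃x∈q∉p {p = inside ∷ p}  {outside ∷ q} lt       _   =
  ∃∈∉-suc (∣p∣≤∣q∣⇒p≢q⇒∃x∈q∉p (<⇒≤ lt) (λ p≡q → <-irrefl (cong ∣_∣ p≡q) lt))

fromDec : ∀ {n} {P : Pred (Fin n) 0ℓ} → Decidable P → Subset n
fromDec P? = tabulate (does ∘ P?)

∈-fromDec⁺ : ∀ {n} {P : Pred (Fin n) 0ℓ} (P? : Decidable P) {x} → P x → x ∈ fromDec P?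
∈-fromDec⁺ P? {x} Px = lookup⇒[]= x _ (trans (lookup∘tabulate (does ∘ P?) x) (dec-true (P? x) Px))

∈-fromDec⁻ : ∀ {n} {P : Pred (Fin n) 0ℓ} (P? : Decidable P) {x} → x ∈ fromDec P? → P x
∈-fromDec⁻ P? {x} x∈ with P? x | trans (sym (lookup∘tabulate (does ∘ P?) x)) ([]=⇒lookup x∈)
... | yes Px | _  = Px
... | no  _  | ()

-- Ranking the k-subsets of an n-set

pascal : ℕ → ℕ → ℕ
pascal n       zero    = 1
pascal zero    (suc k) = 0
pascal (suc n) (suc k) = pascal n k + pascal n (suc k)

pascal≡C : ∀ n k → pascal n k ≡ n C k
pascal≡C zero    zero    = refl
pascal≡C (suc n) zero    = refl
pascal≡C zero    (suc k) = refl
pascal≡C (suc n) (suc k) =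
  trans (cong₂ _+_ (pascal≡C n k) (pascal≡C n (suc k))) (nCk+nC[k+1]≡[n+1]C[k+1] n k)

unrank  : ∀ n k → Fin (pascal n k) → Subset n
unrank⊎ : ∀ n k → Fin (pascal n k) ⊎ Fin (pascal n (suc k)) → Subset (suc n)

unrank n       zero    _ = ⊥
unrank (suc n) (suc k) i = unrank⊎ n k (splitAt (pascal n k) i)

unrank⊎ n k (inj₁ i) = inside  ∷ unrank n k i
unrank⊎ n k (inj₂ i) = outside ∷ unrank n (suc k) i

rank : ∀ {n k} (p : Subset n) → ∣ p ∣ ≡ k → Fin (pascal n k)
rank {k = zero}      _             _ = zero
rank {suc n} {suc k} (inside ∷ p)  e = rank p (suc-injective e) ↑ˡ pascal n (suc k)
rank {suc n} {suc k} (outside ∷ p) e = pascal n k ↑ʳ rank p e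

∣unrank∣ : ∀ n k i → ∣ unrank n k i ∣ ≡ k
∣unrank∣ n zero _ = ∣⊥∣≡0 n
∣unrank∣ (suc n) (suc k) i with splitAt (pascal n k) i
... | inj₁ j = cong suc (∣unrank∣ n k j)
... | inj₂ j = ∣unrank∣ n (suc k) j

unrank-rank : ∀ {n k} (p : Subset n) (e : ∣ p ∣ ≡ k) → unrank n k (rank p e) ≡ p
unrank-rank {k = zero} p e = sym (∣p∣≡0⇒p≡⊥ e)
unrank-rank {suc n} {suc k} (inside ∷ p) e
  rewrite splitAt-↑ˡ (pascal n k) (rank p (suc-injective e)) (pascal n (suc k)) =
  cong (inside ∷_) (unrank-rank p (suc-injective e))
unrank-rank {suc n} {suc k} (outside ∷ p) e
  rewrite splitAt-↑ʳ (pascal n k) (pascal n (suc k)) (rank p e) =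
  cong (outside ∷_) (unrank-rank p e)

unrank-injective : ∀ n k {i j} → unrank n k i ≡ unrank n k j → i ≡ j
unrank-injective n       zero    {zero} {zero} _ = refl
unrank-injective (suc n) (suc k) {i} {j} eq =
  Injection.injective (↔⇒↣ +↔⊎)
    (unrank⊎-injective (splitAt (pascal n k) i) (splitAt (pascal n k) j) eq)
  where
  unrank⊎-injective : ∀ a b → unrank⊎ n k a ≡ unrank⊎ n k b → a ≡ b
  unrank⊎-injective (inj₁ a) (inj₁ b) e = cong inj₁ (unrank-injective n k (∷-injectiveʳ e))
  unrank⊎-injective (inj₂ a) (inj₂ b) e = cong inj₂ (unrank-injective n (suc k) (∷-injectiveʳ e))
  unrank⊎-injective (inj₁ a) (inj₂ b) e with () ← ∷-injectiveˡ e
  unrank⊎-injective (inj₂ a) (inj₁ b) e with () ← ∷-injectiveˡ e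

rank-injective : ∀ {n k} {p q : Subset n} (e : ∣ p ∣ ≡ k) (e′ : ∣ q ∣ ≡ k) →
                 rank p e ≡ rank q e′ → p ≡ q
rank-injective {n} {k} {p} {q} e e′ eq =
  trans (sym (unrank-rank p e)) (trans (cong (unrank n k) eq) (unrank-rank q e′))

-- Symmetric chain decompositions

-- The chain c is element c 0 ⊂ ⋯ ⊂ element c (height c); element c i is junk for
-- i > height c.
record SymmetricChainDecomposition (n : ℕ) : Set₁ where
  field
    Chain          : Set
    height base    : Chain → ℕ
    element        : Chain → ℕ → Subset n
    locate         : Subset n → Chain × ℕ
    element-locate : ∀ p → uncurry element (locate p) ≡ p
    locate-bounded : ∀ p → proj₂ (locate p) ≤ height (proj₁ (locate p))
    locate-element : ∀ c {i} → i ≤ height c → locate (element c i) ≡ (c , i)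
    element-⊆-suc  : ∀ c {i} → i < height c → element c i ⊆ element c (suc i)
    ∣element∣      : ∀ c {i} → i ≤ height c → ∣ element c i ∣ ≡ base c + i
    symmetric      : ∀ c → base c + base c + height c ≡ n

  element-mono : ∀ c {i j} → i ≤ j → j ≤ height c → element c i ⊆ element c j
  element-mono c {j = zero}    z≤n   _     = ⊆-refl
  element-mono c {i} {suc j} i≤1+j 1+j≤h with m≤n⇒m<n∨m≡n i≤1+j
  ... | inj₂ refl      = ⊆-refl
  ... | inj₁ (s≤s i≤j) = ⊆-trans (element-mono c i≤j (<⇒≤ 1+j≤h)) (element-⊆-suc c 1+j≤h)

  element-comparable : ∀ c {i j} → i ≤ height c → j ≤ height c →
                       Comparable (element c i) (element c j)
  element-comparable c {i} {j} i≤h j≤h with ≤-total i j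
  ... | inj₁ i≤j = inj₁ (element-mono c i≤j j≤h)
  ... | inj₂ j≤i = inj₂ (element-mono c j≤i i≤h)

  chainOf : Subset n → Chain
  chainOf = proj₁ ∘ locate

  chainOf-element : ∀ c {i} → i ≤ height c → chainOf (element c i) ≡ c
  chainOf-element c i≤h = cong proj₁ (locate-element c i≤h)

  chainOf-comparable : ∀ {p q} → chainOf p ≡ chainOf q → Comparable p q
  chainOf-comparable {p} {q} same =
    subst₂ Comparable (element-locate p) element-locate-q
      (element-comparable (chainOf p) (locate-bounded p) locate-bounded-q)
    where
    element-locate-q : element (chainOf p) (proj₂ (locate q)) ≡ q
    element-locate-q = trans (cong (λ c → element c (proj₂ (locate q))) same) (element-locate q)
    locate-bounded-q : proj₂ (locate q) ≤ height (chainOf p)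
    locate-bounded-q = subst (λ c → proj₂ (locate q) ≤ height c) (sym same) (locate-bounded q)

-- De Bruijn's construction: a chain S₀ ⊂ ⋯ ⊂ Sₕ on the last n points yields the
-- lengthened chain S₀ ⊂ ⋯ ⊂ Sₕ ⊂ {0} ∪ Sₕ and, if h > 0, the shortened chain
-- {0} ∪ S₀ ⊂ ⋯ ⊂ {0} ∪ Sₕ₋₁ on n + 1 points.
module Extension {n : ℕ} (D : SymmetricChainDecomposition n) where
  open SymmetricChainDecomposition D

  Chain⁺ : Set
  Chain⁺ = Chain ⊎ Σ Chain (λ c → 0 < height c)

  height⁺ base⁺ : Chain⁺ → ℕ
  height⁺ (inj₁ c)       = suc (height c)
  height⁺ (inj₂ (c , _)) = pred (height c)
  base⁺ (inj₁ c)       = base c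
  base⁺ (inj₂ (c , _)) = suc (base c)

  ≤pred⇒< : ∀ {i h} → 0 < h → i ≤ pred h → i < h
  ≤pred⇒< 0<h = m≤pred[n]⇒suc[m]≤n ⦃ >-nonZero 0<h ⦄

  lengthened : Chain → ℕ → Subset (suc n)
  lengthened c i with i ≤? height c
  ... | yes _ = outside ∷ element c i
  ... | no  _ = inside ∷ element c (height c)

  lengthened-≤ : ∀ c {i} → i ≤ height c → lengthened c i ≡ outside ∷ element c i
  lengthened-≤ c {i} i≤h with i ≤? height c
  ... | yes _   = refl
  ... | no  i≰h = contradiction i≤h i≰h

  lengthened-top : ∀ c → lengthened c (suc (height c)) ≡ inside ∷ element c (height c)
  lengthened-top c with suc (height c) ≤? height c
  ... | yes h<h = contradiction h<h (<-irrefl refl)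
  ... | no  _   = refl

  element⁺ : Chain⁺ → ℕ → Subset (suc n)
  element⁺ (inj₁ c)       = lengthened c
  element⁺ (inj₂ (c , _)) = (inside ∷_) ∘ element c

  locateInside : Chain → ℕ → Chain⁺ × ℕ
  locateInside c i with i <? height c
  ... | yes i<h = inj₂ (c , ≤-<-trans z≤n i<h) , i
  ... | no  _   = inj₁ c , suc i

  locateInside-top : ∀ c → locateInside c (height c) ≡ (inj₁ c , suc (height c))
  locateInside-top c with height c <? height c
  ... | yes h<h = contradiction h<h (<-irrefl refl)
  ... | no  _   = refl

  locateInside-below : ∀ c {i} (0<h : 0 < height c) → i < height c →
                       locateInside c i ≡ (inj₂ (c , 0<h) , i)
  locateInside-below c {i} 0<h i<h with i <? height c
  ... | yes _   = cong (λ 0<h → inj₂ (c , 0<h) , i) (<-irrelevant _ _)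
  ... | no  i≮h = contradiction i<h i≮h

  element-locateInside : ∀ c {i} → i ≤ height c →
                         uncurry element⁺ (locateInside c i) ≡ inside ∷ element c i
  element-locateInside c {i} i≤h with i <? height c
  ... | yes _   = refl
  ... | no  i≮h rewrite ≤-antisym i≤h (≮⇒≥ i≮h) = lengthened-top c

  locateInside-bounded : ∀ c {i} → i ≤ height c →
                         proj₂ (locateInside c i) ≤ height⁺ (proj₁ (locateInside c i))
  locateInside-bounded c {i} i≤h with i <? height c
  ... | yes i<h = <⇒≤pred i<h
  ... | no  _   = s≤s i≤h

  locate⁺ : Subset (suc n) → Chain⁺ × ℕ
  locate⁺ (outside ∷ p) = Prod.map₁ inj₁ (locate p)
  locate⁺ (inside  ∷ p) = uncurry locateInside (locate p)

  element-locate⁺ : ∀ p → uncurry element⁺ (locate⁺ p) ≡ p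
  element-locate⁺ (outside ∷ p) =
    trans (lengthened-≤ _ (locate-bounded p)) (cong (outside ∷_) (element-locate p))
  element-locate⁺ (inside ∷ p) =
    trans (element-locateInside _ (locate-bounded p)) (cong (inside ∷_) (element-locate p))

  locate-bounded⁺ : ∀ p → proj₂ (locate⁺ p) ≤ height⁺ (proj₁ (locate⁺ p))
  locate-bounded⁺ (outside ∷ p) = m≤n⇒m≤1+n (locate-bounded p)
  locate-bounded⁺ (inside  ∷ p) = locateInside-bounded _ (locate-bounded p)

  locate-element⁺ : ∀ c {i} → i ≤ height⁺ c → locate⁺ (element⁺ c i) ≡ (c , i)
  locate-element⁺ (inj₁ c) {i} i≤1+h with m≤n⇒m<n∨m≡n i≤1+h
  ... | inj₁ (s≤s i≤h) rewrite lengthened-≤ c i≤h = cong (Prod.map₁ inj₁) (locate-element c i≤h)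
  ... | inj₂ refl      rewrite lengthened-top c =
    trans (cong (uncurry locateInside) (locate-element c ≤-refl)) (locateInside-top c)
  locate-element⁺ (inj₂ (c , 0<h)) {i} i≤h-1 =
    trans (cong (uncurry locateInside) (locate-element c (<⇒≤ i<h))) (locateInside-below c 0<h i<h)
    where
    i<h : i < height c
    i<h = ≤pred⇒< 0<h i≤h-1

  element-⊆-suc⁺ : ∀ c {i} → i < height⁺ c → element⁺ c i ⊆ element⁺ c (suc i)
  element-⊆-suc⁺ (inj₁ c) (s≤s i≤h) with m≤n⇒m<n∨m≡n i≤h
  ... | inj₁ i<h rewrite lengthened-≤ c (<⇒≤ i<h) | lengthened-≤ c i<h = s⊆s (element-⊆-suc c i<h)
  ... | inj₂ refl rewrite lengthened-≤ c (≤-refl {height c}) | lengthened-top c = out⊆ ⊆-refl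
  element-⊆-suc⁺ (inj₂ (c , 0<h)) 1+i≤h-1 =
    s⊆s (element-⊆-suc c (<⇒≤ (≤pred⇒< 0<h 1+i≤h-1)))

  ∣element∣⁺ : ∀ c {i} → i ≤ height⁺ c → ∣ element⁺ c i ∣ ≡ base⁺ c + i
  ∣element∣⁺ (inj₁ c) {i} i≤1+h with m≤n⇒m<n∨m≡n i≤1+h
  ... | inj₁ (s≤s i≤h) rewrite lengthened-≤ c i≤h = ∣element∣ c i≤h
  ... | inj₂ refl      rewrite lengthened-top c =
    trans (cong suc (∣element∣ c ≤-refl)) (sym (+-suc (base c) (height c)))
  ∣element∣⁺ (inj₂ (c , 0<h)) i≤h-1 =
    cong suc (∣element∣ c (<⇒≤ (≤pred⇒< 0<h i≤h-1)))

  symmetric⁺ : ∀ c → base⁺ c + base⁺ c + height⁺ c ≡ suc n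
  symmetric⁺ (inj₁ c) = trans (+-suc (base c + base c) (height c)) (cong suc (symmetric c))
  symmetric⁺ (inj₂ (c , 0<h)) = begin
    suc b + suc b + pred h    ≡⟨ cong (λ x → suc x + pred h) (+-suc b b) ⟩
    suc (suc (b + b) + pred h) ≡⟨ cong suc (+-suc (b + b) (pred h)) ⟨
    suc (b + b + suc (pred h)) ≡⟨ cong (λ x → suc (b + b + x)) (suc-pred h ⦃ >-nonZero 0<h ⦄) ⟩
    suc (b + b + h)           ≡⟨ cong suc (symmetric c) ⟩
    suc n                     ∎
    where
    open ≡-Reasoning
    b h : ℕ
    b = base c
    h = height c

  extension : SymmetricChainDecomposition (suc n)
  extension = record
    { Chain          = Chain⁺
    ; height         = height⁺
    ; base           = base⁺
    ; element        = element⁺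
    ; locate         = locate⁺
    ; element-locate = element-locate⁺
    ; locate-bounded = locate-bounded⁺
    ; locate-element = locate-element⁺
    ; element-⊆-suc  = element-⊆-suc⁺
    ; ∣element∣      = ∣element∣⁺
    ; symmetric      = symmetric⁺
    }

symmetricChainDecomposition : ∀ n → SymmetricChainDecomposition n
symmetricChainDecomposition zero    = record
  { Chain          = ⊤
  ; height         = λ _ → 0
  ; base           = λ _ → 0
  ; element        = λ _ _ → []
  ; locate         = λ _ → tt , 0
  ; element-locate = λ { [] → refl }
  ; locate-bounded = λ _ → z≤n
  ; locate-element = λ { _ z≤n → refl }
  ; element-⊆-suc  = λ _ ()
  ; ∣element∣      = λ { _ z≤n → refl }
  ; symmetric      = λ _ → refl
  }
symmetricChainDecomposition (suc n) = Extension.extension (symmetricChainDecomposition n)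

b≤[b+b+h]/2 : ∀ b h → b ≤ (b + b + h) / 2
b≤[b+b+h]/2 b h = begin
  b                 ≡⟨ m*n/n≡m b 2 ⟨
  b * 2 / 2         ≡⟨ cong (_/ 2) (b*2≡b+b b) ⟩
  (b + b) / 2       ≤⟨ /-monoˡ-≤ {m = b + b} 2 (m≤m+n (b + b) h) ⟩
  (b + b + h) / 2   ∎
  where
  open ≤-Reasoning
  b*2≡b+b : ∀ b → b * 2 ≡ b + b
  b*2≡b+b = solve-∀

[b+b+h]/2≤b+h : ∀ b h → (b + b + h) / 2 ≤ b + h
[b+b+h]/2≤b+h b h = begin
  (b + b + h) / 2       ≤⟨ /-monoˡ-≤ {m = b + b + h} 2 (m≤m+n (b + b + h) h) ⟩
  (b + b + h + h) / 2   ≡⟨ cong (_/ 2) (b+b+h+h≡[b+h]*2 b h) ⟩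
  (b + h) * 2 / 2       ≡⟨ m*n/n≡m (b + h) 2 ⟩
  b + h                 ∎
  where
  open ≤-Reasoning
  b+b+h+h≡[b+h]*2 : ∀ b h → b + b + h + h ≡ (b + h) * 2
  b+b+h+h≡[b+h]*2 = solve-∀

module MiddleLevel {n : ℕ} (D : SymmetricChainDecomposition n) where
  open SymmetricChainDecomposition D

  middleIndex : Chain → ℕ
  middleIndex c = n / 2 ∸ base c

  middleIndex≤height : ∀ c → middleIndex c ≤ height c
  middleIndex≤height c = m≤n+o⇒m∸n≤o (n / 2) (base c)
    (subst (λ m → m / 2 ≤ base c + height c) (symmetric c) ([b+b+h]/2≤b+h (base c) (height c)))

  base+middleIndex : ∀ c → base c + middleIndex c ≡ n / 2
  base+middleIndex c = m+[n∸m]≡n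
    (subst (λ m → base c ≤ m / 2) (symmetric c) (b≤[b+b+h]/2 (base c) (height c)))

  middle : Subset n → Subset n
  middle p = element (chainOf p) (middleIndex (chainOf p))

  ∣middle∣ : ∀ p → ∣ middle p ∣ ≡ n / 2
  ∣middle∣ p = trans (∣element∣ c (middleIndex≤height c)) (base+middleIndex c)
    where
    c : Chain
    c = chainOf p

  chainOf-middle : ∀ p → chainOf (middle p) ≡ chainOf p
  chainOf-middle p = chainOf-element (chainOf p) (middleIndex≤height (chainOf p))

  middle-comparable : ∀ {p q} → middle p ≡ middle q → Comparable p q
  middle-comparable {p} {q} eq =
    chainOf-comparable (trans (sym (chainOf-middle p)) (trans (cong chainOf eq) (chainOf-middle q)))

middleRank : ∀ {n} → Subset n → Fin (pascal n (n / 2))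
middleRank {n} p = rank (middle p) (∣middle∣ p)
  where open MiddleLevel (symmetricChainDecomposition n)

middleRank-comparable : ∀ {n} {p q : Subset n} → middleRank p ≡ middleRank q → Comparable p q
middleRank-comparable {n} eq = middle-comparable (rank-injective (∣middle∣ _) (∣middle∣ _) eq)
  where open MiddleLevel (symmetricChainDecomposition n)

-- Line digraphs and arc colourings

module Finite {X : Set} (finite : IsFiniteSet X) where
  private
    module F = Inverse (proj₂ finite)

  enumerate : List X
  enumerate = List.map F.from (allFin (proj₁ finite))

  ∈-enumerate : ∀ x → x ∈ₗ enumerate
  ∈-enumerate x =
    subst (_∈ₗ enumerate) (F.strictlyInverseʳ x) (∈-map⁺ F.from (∈-allFin (F.to x)))

  _≟_ : DecidableEquality X
  _≟_ = via-injection (↔⇒↣ (proj₂ finite)) Fin._≟_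

  ∃? : ∀ {P : Pred X 0ℓ} → Decidable P → Dec (∃ P)
  ∃? {P} P? = map′ (λ (i , Pi) → F.from i , Pi) witness (any? (P? ∘ F.from))
    where
    witness : ∃ P → ∃ (P ∘ F.from)
    witness (x , Px) = F.to x , subst P (sym (F.strictlyInverseʳ x)) Px

module _ (G : Digraph) (finite : IsFinite G) where
  open Finite (proj₁ finite) using (_≟_)
  open Finite (proj₂ finite) using (∈-enumerate) renaming (enumerate to arcs)

  Consecutive : Pred (A G × A G) 0ℓ
  Consecutive (a , b) = head G a ≡ tail G b

  consecutive? : Decidable Consecutive
  consecutive? (a , b) = head G a ≟ tail G b

  consecutivePairs : List (A G × A G)
  consecutivePairs = filter consecutive? (cartesianProduct arcs arcs)

  -- Arcs are positions in consecutivePairs, so that the arc type is visibly finite.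
  lineDigraph : Digraph
  lineDigraph = record
    { V    = A G
    ; A    = Fin (length consecutivePairs)
    ; tail = proj₁ ∘ lookup consecutivePairs
    ; head = proj₂ ∘ lookup consecutivePairs
    }

  lineDigraph-finite : IsFinite lineDigraph
  lineDigraph-finite = proj₂ finite , length consecutivePairs , ↔-refl

  lineDigraph-consecutive : ∀ k → Consecutive (lookup consecutivePairs k)
  lineDigraph-consecutive k =
    proj₂ (∈-filter⁻ consecutive? {xs = cartesianProduct arcs arcs} (∈-lookup k))

  lineDigraph-complete : ∀ a b → Consecutive (a , b) →
                         ∃ λ k → lookup consecutivePairs k ≡ (a , b)
  lineDigraph-complete a b a⇢b = index ab∈ , sym (lookup-index ab∈)
    where
    ab∈ : (a , b) ∈ₗ consecutivePairs
    ab∈ = ∈-filter⁺ consecutive? (∈-cartesianProduct⁺ (∈-enumerate a) (∈-enumerate b)) a⇢b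

record ArcColouring (G : Digraph) (n : ℕ) : Set where
  field
    colour               : A G → Fin n
    consecutive-distinct : ∀ a b → head G a ≡ tail G b → colour a ≢ colour b

unrank-separates : ∀ n k {i j : Fin (pascal n k)} → i ≢ j →
                   ∃ λ x → x ∈ unrank n k j × x ∉ unrank n k i
unrank-separates n k {i} {j} i≢j = ∣p∣≤∣q∣⇒p≢q⇒∃x∈q∉p
  (≤-reflexive (trans (∣unrank∣ n k i) (sym (∣unrank∣ n k j))))
  (i≢j ∘ unrank-injective n k)

hom⇒arcColouring : ∀ {G} n k → G ⟶ K (pascal n k) → ArcColouring G n
hom⇒arcColouring {G} n k φ = record
  { colour               = colour
  ; consecutive-distinct = λ a b a⇢b same →
      colour∉tail b (subst (_∈ S (tail G b)) same
                      (subst (λ v → colour a ∈ S v) a⇢b (colour∈head a)))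
  }
  where
  open Hom φ
  S : V G → Subset n
  S = unrank n k ∘ vmap
  separation : ∀ a → ∃ λ x → x ∈ unrank n k (head (K _) (amap a))
                           × x ∉ unrank n k (tail (K _) (amap a))
  separation a = unrank-separates n k (proj₂ (amap a))
  colour : A G → Fin n
  colour = proj₁ ∘ separation
  colour∈head : ∀ a → colour a ∈ S (head G a)
  colour∈head a = subst (λ v → colour a ∈ unrank n k v) (head-comm a) (proj₁ (proj₂ (separation a)))
  colour∉tail : ∀ a → colour a ∉ S (tail G a)
  colour∉tail a = subst (λ v → colour a ∉ unrank n k v) (tail-comm a) (proj₂ (proj₂ (separation a)))

arcColouring⇒lineHom : ∀ {G H n} (finG : IsFinite G) (finH : IsFinite H) → ArcColouring (G ⊗ H) n →
                       (lineDigraph G finG ⊗ lineDigraph H finH) ⟶ K n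
arcColouring⇒lineHom {G} {H} finG finH χ = record
  { vmap      = colour
  ; amap      = λ (k , l) → (colour (tail LG k , tail LH l) , colour (head LG k , head LH l))
                          , consecutive-distinct _ _ (cong₂ _,_ (lineDigraph-consecutive G finG k)
                                                                (lineDigraph-consecutive H finH l))
  ; tail-comm = λ _ → refl
  ; head-comm = λ _ → refl
  }
  where
  open ArcColouring χ
  LG LH : Digraph
  LG = lineDigraph G finG
  LH = lineDigraph H finH

lineHom⇒arcColouring : ∀ {G n} (finite : IsFinite G) → lineDigraph G finite ⟶ K n → ArcColouring G n
lineHom⇒arcColouring {G} finite φ = record
  { colour               = vmap
  ; consecutive-distinct = λ a b a⇢b same →
      let (k , k↦ab) = lineDigraph-complete G finite a b a⇢b
      in proj₂ (amap k) (begin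
           tail (K _) (amap k)   ≡⟨ tail-comm k ⟩
           vmap (tail LG k)      ≡⟨ cong (vmap ∘ proj₁) k↦ab ⟩
           vmap a                ≡⟨ same ⟩
           vmap b                ≡⟨ cong (vmap ∘ proj₂) k↦ab ⟨
           vmap (head LG k)      ≡⟨ head-comm k ⟨
           head (K _) (amap k)   ∎)
  }
  where
  open Hom φ
  open ≡-Reasoning
  LG : Digraph
  LG = lineDigraph G finite

module _ {G : Digraph} {n : ℕ} (finite : IsFinite G) (χ : ArcColouring G n) where
  open ArcColouring χ
  open Finite (proj₁ finite) using (_≟_)
  open Finite (proj₂ finite) using (∃?)

  EnteringColour : V G → Pred (Fin n) 0ℓ
  EnteringColour v x = ∃ λ a → head G a ≡ v × colour a ≡ x

  enteringColour? : ∀ v → Decidable (EnteringColour v)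
  enteringColour? v x = ∃? (λ a → (head G a ≟ v) ×-dec (colour a Fin.≟ x))

  entering : V G → Subset n
  entering v = fromDec (enteringColour? v)

  colour∈entering : ∀ a → colour a ∈ entering (head G a)
  colour∈entering a = ∈-fromDec⁺ (enteringColour? (head G a)) (a , refl , refl)

  colour∉entering : ∀ a → colour a ∉ entering (tail G a)
  colour∉entering a c∈ with ∈-fromDec⁻ (enteringColour? (tail G a)) c∈
  ... | b , b⇢a , same = consecutive-distinct b a b⇢a same

  entering-head⊈tail : ∀ a → entering (head G a) ⊈ entering (tail G a)
  entering-head⊈tail a head⊆tail = colour∉entering a (head⊆tail (colour∈entering a))

  entering-incomparable : IsSymmetric G →
                          ∀ a → ¬ Comparable (entering (tail G a)) (entering (head G a))
  entering-incomparable symmetric a (inj₂ head⊆tail) = entering-head⊈tail a head⊆tail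
  entering-incomparable symmetric a (inj₁ tail⊆head) with symmetric a
  ... | a′ , tail≡head , head≡tail = entering-head⊈tail a′
          (subst₂ (λ u v → entering u ⊆ entering v) (sym head≡tail) (sym tail≡head) tail⊆head)

  arcColouring⇒hom : IsSymmetric G → G ⟶ K (pascal n (n / 2))
  arcColouring⇒hom symmetric = record
    { vmap      = middleRank ∘ entering
    ; amap      = λ a → (middleRank (entering (tail G a)) , middleRank (entering (head G a)))
                      , entering-incomparable symmetric a ∘ middleRank-comparable
    ; tail-comm = λ _ → refl
    ; head-comm = λ _ → refl
    }

mainTheorem2 : (n : ℕ) → 1 ≤ n → MultiplicativeDigraphs (K n) →
    MultiplicativeGraphs (K (n C (n / 2)))
mainTheorem2 n _ multiplicative =
  subst (MultiplicativeGraphs ∘ K) (pascal≡C n (n / 2)) multiplicative′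
  where
  multiplicative′ : MultiplicativeGraphs (K (pascal n (n / 2)))
  multiplicative′ G H finG (_ , symG) finH (_ , symH) φ =
    Sum.map (λ ψ → arcColouring⇒hom finG (lineHom⇒arcColouring finG ψ) symG)
            (λ ψ → arcColouring⇒hom finH (lineHom⇒arcColouring finH ψ) symH)
            (multiplicative (lineDigraph G finG) (lineDigraph H finH)
              (lineDigraph-finite G finG) (lineDigraph-finite H finH)
              (arcColouring⇒lineHom finG finH (hom⇒arcColouring n (n / 2) φ)))
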